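{- Let $q$ be a prime power and $v,k,d$ positive integers with $d$ even and $d\le 2k\le v$. Let $\mathcal{C}$ be a set of $k$-dimensional subspaces of $\mathbb{F}_q^v$ with pairwise subspace distance at least $d$ which contains a lifted MRD code $\mathcal{C}'$ of cardinality $q^{(v-k)(k-d/2+1)}$ as a subset. Then $\#\mathcal{C}\le q^{(v-k)(k-d/2+1)}+B_q(v,v-k,d;k)$.
   Context: The subspace distance between subspaces $U,W$ is $\mathrm{d}_{\mathrm{s}}(U,W)=\dim(U+W)-\dim(U\cap W)$. A lifted MRD code here is a set of $k$-spaces of the form $\{\text{rowspace}(I_{k}\,|\,A) : A\in\mathcal{M}\}\subseteq$ subspaces of $\mathbb{F}_q^v$, where $I_k$ is the $k\times k$ identity matrix, $(I_k|A)$ is concatenation, and $\mathcal{M}\subseteq\mathbb{F}_q^{k\times(v-k)}$ is a set of matrices with $\mathrm{rk}(A-A')\ge d/2$ for all distinct $A,A'\in\mathcal{M}$ and $\#\mathcal{M}=q^{(v-k)(k-d/2+1)}$ (a maximum rank distance code). For integers $0\le v_2\le v_1$, $B_q(v_1,v_2,d;k)$ denotes the maximum number of $k$-dimensional subspaces of $\mathbb{F}_q^{v_1}$ with pairwise subspace distance at least $d$ such that there exists a $v_2$-dimensional subspace $W$ of $\mathbb{F}_q^{v_1}$ intersecting every chosen $k$-space in dimension at least $d/2$. -}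

module Defs where

open import Data.Nat as ℕ using (ℕ; zero; suc; _≤_; _∸_; ⌊_/2⌋)
open import Data.Nat.Properties using (m+[n∸m]≡n; ≤-trans; m≤m+n)
open import Data.Fin using (Fin; splitAt; cast)
open import Data.Fin.Properties as FinP using ()
open import Data.Bool using (if_then_else_)
open import Data.Sum using (inj₁; inj₂)
open import Data.Product using (Σ; ∃; ∃₂; _×_; _,_)
open import Data.List using (List; length; lookup)
open import Relation.Binary.PropositionalEquality using (_≡_; sym)
open import Relation.Nullary using (¬_; does)
open import Algebra.Structures using (IsCommutativeRing)
open import Function.Bundles using (_↔_)

-- A finite field with exactly q elements (q is then necessarily a prime power).
-- Equality on the carrier is propositional equality.
record FiniteField (q : ℕ) : Set₁ where
  infixl 6 _+_
  infixl 7 _*_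
  field
    Carrier : Set
    _+_ _*_ : Carrier → Carrier → Carrier
    -_ : Carrier → Carrier
    0# 1# : Carrier
    isCommutativeRing : IsCommutativeRing _≡_ _+_ _*_ -_ 0# 1#
    _⁻¹ : Carrier → Carrier
    ⁻¹-inverse : ∀ x → ¬ x ≡ 0# → x * (x ⁻¹) ≡ 1#
    0≢1 : ¬ 0# ≡ 1#
    enumeration : Fin q ↔ Carrier

2k≤v⇒k≤v : ∀ {k v} → 2 ℕ.* k ≤ v → k ≤ v
2k≤v⇒k≤v {k} h = ≤-trans (m≤m+n k (k ℕ.+ 0)) h

module LinAlg {q : ℕ} (F : FiniteField q) where
  open FiniteField F

  Pt : ℕ → Set
  Pt n = Fin n → Carrier

  _≈_ : ∀ {n} → Pt n → Pt n → Set
  x ≈ y = ∀ i → x i ≡ y i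

  zeroV : ∀ {n} → Pt n
  zeroV _ = 0#

  _⊕_ : ∀ {n} → Pt n → Pt n → Pt n
  (x ⊕ y) i = x i + y i

  _·_ : ∀ {n} → Carrier → Pt n → Pt n
  (c · x) i = c * x i

  ∑ : ∀ {m n} → (Fin m → Pt n) → Pt n
  ∑ {zero}  f = zeroV
  ∑ {suc m} f = f Fin.zero ⊕ ∑ (λ i → f (Fin.suc i))

  linComb : ∀ {m n} → (Fin m → Carrier) → (Fin m → Pt n) → Pt n
  linComb c b = ∑ (λ i → c i · b i)

  VSet : ℕ → Set₁
  VSet n = Pt n → Set

  record IsSubspace {n : ℕ} (U : VSet n) : Set where
    field
      respects : ∀ {x y} → x ≈ y → U x → U y
      zero-mem : U zeroV
      add-mem : ∀ {x y} → U x → U y → U (x ⊕ y)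
      scale-mem : ∀ c {x} → U x → U (c · x)

  Subspace : ℕ → Set₁
  Subspace n = Σ (VSet n) IsSubspace

  elems : ∀ {n} → Subspace n → VSet n
  elems (U , _) = U

  LinIndep : ∀ {m n} → (Fin m → Pt n) → Set
  LinIndep b = ∀ c → linComb c b ≈ zeroV → ∀ i → c i ≡ 0#

  IsBasis : ∀ {m n} → VSet n → (Fin m → Pt n) → Set
  IsBasis U b = (∀ i → U (b i)) × LinIndep b
              × (∀ x → U x → ∃ λ c → x ≈ linComb c b)

  HasDim : ∀ {n} → VSet n → ℕ → Set
  HasDim {n} U m = ∃ λ (b : Fin m → Pt n) → IsBasis U b

  _+ˢ_ : ∀ {n} → VSet n → VSet n → VSet n
  (U +ˢ W) x = ∃₂ λ u w → U u × W w × x ≈ (u ⊕ w)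

  _∩ˢ_ : ∀ {n} → VSet n → VSet n → VSet n
  (U ∩ˢ W) x = U x × W x

  SameSpace : ∀ {n} → VSet n → VSet n → Set
  SameSpace U W = ∀ x → (U x → W x) × (W x → U x)

  -- subspace distance d_s(U,W) = dim(U+W) - dim(U∩W) is at least d
  DistAtLeast : ∀ {n} → ℕ → Subspace n → Subspace n → Set
  DistAtLeast d U W = ∃₂ λ a b → HasDim ((elems U) +ˢ (elems W)) a
                      × HasDim ((elems U) ∩ˢ (elems W)) b × d ℕ.+ b ≤ a

  Pairwise : ∀ {a} {A : Set a} → (A → A → Set) → List A → Set
  Pairwise R xs = ∀ i j → ¬ i ≡ j → R (lookup xs i) (lookup xs j)

  Mat : ℕ → ℕ → Set
  Mat r c = Fin r → Pt c

  _-ᴹ_ : ∀ {r c} → Mat r c → Mat r c → Mat r c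
  (A -ᴹ B) i j = A i j + - (B i j)

  rowspace : ∀ {r c} → Mat r c → VSet c
  rowspace A x = ∃ λ coeffs → x ≈ linComb coeffs A

  RankDistAtLeast : ∀ {r c} → ℕ → Mat r c → Mat r c → Set
  RankDistAtLeast s A B = ∃ λ ρ → HasDim (rowspace (A -ᴹ B)) ρ × s ≤ ρ

  identity : ∀ {k} → Mat k k
  identity i j = if does (i FinP.≟ j) then 1# else 0#

  augment : ∀ {k m} → Mat k m → Mat k (k ℕ.+ m)
  augment {k} A i j with splitAt k j
  ... | inj₁ a = identity i a
  ... | inj₂ b = A i b

  -- (I_k | A) as a k × v matrix, using v = k + (v - k)
  liftMat : ∀ {k v} → .(k ≤ v) → Mat k (v ∸ k) → Mat k v
  liftMat {k} {v} h A i j = augment A i (cast (sym (m+[n∸m]≡n h)) j)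

  -- M is an MRD code in F_q^{k×(v-k)} for minimum subspace distance d
  IsMRD : (v k d : ℕ) → List (Mat k (v ∸ k)) → Set
  IsMRD v k d M = Pairwise (RankDistAtLeast ⌊ d /2⌋) M
                × length M ≡ q ℕ.^ ((v ∸ k) ℕ.* (k ∸ ⌊ d /2⌋ ℕ.+ 1))

  IsBCode : (v1 v2 d k : ℕ) → List (Subspace v1) → Set₁
  IsBCode v1 v2 d k D =
      (∀ i → HasDim (elems (lookup D i)) k)
    × Pairwise (DistAtLeast d) D
    × (∃ λ (W : Subspace v1) → HasDim (elems W) v2
         × (∀ i → ∃ λ b → HasDim ((elems (lookup D i)) ∩ˢ (elems W)) b × ⌊ d /2⌋ ≤ b))

  IsBValue : (v1 v2 d k : ℕ) → ℕ → Set₁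
  IsBValue v1 v2 d k n =
      (∃ λ D → IsBCode v1 v2 d k D × length D ≡ n)
    × (∀ D → IsBCode v1 v2 d k D → length D ≤ n)

-- Let W be the (v - k)-space of vectors whose first k coordinates vanish, π the projection
-- onto those k coordinates, δ = d/2 and r = k - δ + 1. An MRD code with q^((v-k)r) codewords
-- and minimum rank distance δ takes every prescribed value on any r independent vectors of
-- F_q^k: two codewords agreeing there differ by a matrix of rank at most k - r < δ. Now let
-- U ∈ C meet W in dimension < δ. Then dim πU ≥ r, so U contains r independent vectors with
-- independent projections, and by the above they lie in a lifted codeword. U then shares an
-- r-space with that codeword and their distance is at most 2(k - r) < d, so U is a lifted codeword.
-- Hence the remaining elements of C form a code counted by B_q(v, v - k, d; k), with witness W.

module Submission where

open import Defs
open import Algebra.Bundles using (CommutativeRing)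
open import Data.Empty using (⊥-elim)
open import Data.Fin as Fin using (Fin; splitAt; cast; _↑ˡ_; _↑ʳ_; punchIn; punchOut; combine; remQuot)
import Data.Fin.Properties as FinP
open import Data.List using (List; length; lookup; tabulate)
import Data.List.Properties as ListP
import Data.Nat as ℕ
open ℕ using (ℕ; zero; suc; _≤_; _∸_; _^_; ⌊_/2⌋)
open import Data.Nat.Divisibility using (_∣_; divides)
import Data.Nat.Properties as ℕP
open import Data.Nat.Solver using (module +-*-Solver)
open import Data.Product using (Σ; ∃; _×_; _,_; proj₁; proj₂)
open import Data.Sum using (inj₁; inj₂; [_,_])
open import Data.Vec.Functional using (_∷_; _++_; head; tail)
open import Data.Vec.Functional.Properties using (lookup-++ˡ; lookup-++ʳ)
open import Data.Vec.Functional.Relation.Binary.Pointwise using (Pointwise)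
import Data.Vec.Functional.Relation.Binary.Pointwise.Properties as Pointwise
open import Function.Base using (_∘_)
open import Function.Bundles using (Inverse)
open import Function.Definitions using (Injective)
open import Relation.Binary.Structures using (IsEquivalence)
open import Relation.Binary.PropositionalEquality
  using (_≡_; _≢_; refl; sym; trans; cong; cong₂; subst; subst₂; module ≡-Reasoning)
  renaming (isEquivalence to ≡-isEquivalence)
open import Relation.Nullary using (¬_; Dec; yes; no; ¬?)
open import Relation.Nullary.Decidable using (map′; _×-dec_; decidable-stable)

injective⇒surjective : ∀ {n} (f : Fin n → Fin n) → Injective _≡_ _≡_ f → ∀ y → ∃ λ x → f x ≡ y
injective⇒surjective {suc n} f inj y with FinP.any? (λ x → f x FinP.≟ y)
... | yes hit = hit
... | no miss = ⊥-elim (FinP.<⇒notInjective (ℕP.n<1+n n) g-injective)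
  where
  y≢f : ∀ x → y ≢ f x
  y≢f x eq = miss (x , sym eq)
  g : Fin (suc n) → Fin n
  g x = punchOut (y≢f x)
  g-injective : Injective _≡_ _≡_ g
  g-injective eq = inj (FinP.punchOut-injective (y≢f _) (y≢f _) eq)

cast-injective : ∀ {m n} .(eq : m ≡ n) {i j : Fin m} → cast eq i ≡ cast eq j → i ≡ j
cast-injective eq {i} {j} h = begin
  i                         ≡⟨ FinP.cast-involutive (sym eq) eq i ⟨
  cast (sym eq) (cast eq i) ≡⟨ cong (cast (sym eq)) h ⟩
  cast (sym eq) (cast eq j) ≡⟨ FinP.cast-involutive (sym eq) eq j ⟩
  j                         ∎
  where open ≡-Reasoning

record Encoding {A : Set} (_∼_ : A → A → Set) (N : ℕ) : Set where
  field
    isEquivalence : IsEquivalence _∼_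
    encode        : A → Fin N
    decode        : Fin N → A
    decode-encode : ∀ x → decode (encode x) ∼ x
    encode-cong   : ∀ {x y} → x ∼ y → encode x ≡ encode y

  private module ∼ = IsEquivalence isEquivalence

  encode-injective : ∀ {x y} → encode x ≡ encode y → x ∼ y
  encode-injective {x} {y} eq =
    ∼.trans (∼.sym (decode-encode x)) (subst (λ i → decode i ∼ y) (sym eq) (decode-encode y))

  _≟_ : ∀ x y → Dec (x ∼ y)
  x ≟ y = map′ encode-injective encode-cong (encode x FinP.≟ encode y)

  any? : (P : A → Set) → (∀ x → Dec (P x)) → (∀ {x y} → x ∼ y → P x → P y) → Dec (∃ P)
  any? P P? resp with FinP.any? (λ i → P? (decode i))
  ... | yes (i , p) = yes (decode i , p)
  ... | no none     = no λ (x , px) → none (encode x , resp (∼.sym (decode-encode x)) px)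

  injective⇒onto : ∀ {L} → L ≡ N → (f : Fin L → A) → (∀ {i j} → f i ∼ f j → i ≡ j) →
                   ∀ x → ∃ λ i → f i ∼ x
  injective⇒onto refl f inj x with injective⇒surjective (encode ∘ f) (inj ∘ encode-injective) (encode x)
  ... | i , eq = i , encode-injective eq

vectorEncoding : ∀ {A : Set} {_∼_ : A → A → Set} {N} → Encoding _∼_ N → ∀ n → Encoding (Pointwise _∼_ {n}) (N ^ n)
vectorEncoding {A} {_∼_} {N} E n = record
  { isEquivalence = Pointwise.isEquivalence E.isEquivalence n
  ; encode        = enc n
  ; decode        = dec n
  ; decode-encode = dec-enc n
  ; encode-cong   = enc-cong n
  }
  where
  module E = Encoding E
  enc : ∀ r → (Fin r → A) → Fin (N ^ r)
  enc zero    f = Fin.zero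
  enc (suc r) f = combine (E.encode (head f)) (enc r (tail f))
  dec : ∀ r → Fin (N ^ r) → Fin r → A
  uncons : ∀ r → Fin N × Fin (N ^ r) → Fin (suc r) → A
  dec zero    i = λ ()
  dec (suc r) i = uncons r (remQuot (N ^ r) i)
  uncons r (x , y) = E.decode x ∷ dec r y
  dec-enc : ∀ r f → Pointwise _∼_ (dec r (enc r f)) f
  dec-enc (suc r) f =
    subst (λ p → Pointwise _∼_ (uncons r p) f)
          (sym (FinP.remQuot-combine (E.encode (head f)) (enc r (tail f))))
          (FinP.∀-cons (E.decode-encode (head f)) (dec-enc r (tail f)))
  enc-cong : ∀ r {f g} → Pointwise _∼_ f g → enc r f ≡ enc r g
  enc-cong zero    f∼g = refl
  enc-cong (suc r) f∼g = cong₂ combine (E.encode-cong (f∼g Fin.zero)) (enc-cong r (f∼g ∘ Fin.suc))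

record Partition {n} (Q : Fin n → Set) : Set where
  field
    #in #out          : ℕ
    #in+#out≡n        : #in ℕ.+ #out ≡ n
    inside            : Fin #in → Fin n
    outside           : Fin #out → Fin n
    inside-holds      : ∀ i → Q (inside i)
    outside-fails     : ∀ i → ¬ Q (outside i)
    inside-injective  : Injective _≡_ _≡_ inside
    outside-injective : Injective _≡_ _≡_ outside

suc∘-injective : ∀ {m n} {g : Fin m → Fin n} → Injective _≡_ _≡_ g → Injective _≡_ _≡_ (Fin.suc ∘ g)
suc∘-injective inj eq = inj (FinP.suc-injective eq)

zero∷suc∘-injective : ∀ {m n} {g : Fin m → Fin n} → Injective _≡_ _≡_ g →
                      Injective _≡_ _≡_ (Fin.zero ∷ Fin.suc ∘ g)
zero∷suc∘-injective inj {Fin.zero}  {Fin.zero}  eq = refl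
zero∷suc∘-injective inj {Fin.suc i} {Fin.suc j} eq = cong Fin.suc (suc∘-injective inj eq)

partition : ∀ {n} {Q : Fin n → Set} → (∀ i → Dec (Q i)) → Partition Q
partition {zero} Q? = record
  { #in = 0 ; #out = 0 ; #in+#out≡n = refl ; inside = λ () ; outside = λ ()
  ; inside-holds = λ () ; outside-fails = λ ()
  ; inside-injective = λ {i} → ⊥-elim (FinP.¬Fin0 i) ; outside-injective = λ {i} → ⊥-elim (FinP.¬Fin0 i) }
partition {suc n} {Q} Q? with partition (Q? ∘ Fin.suc) | Q? Fin.zero
... | P | yes q0 = record
  { #in = suc #in ; #out = #out ; #in+#out≡n = cong suc #in+#out≡n
  ; inside = Fin.zero ∷ Fin.suc ∘ inside ; outside = Fin.suc ∘ outside
  ; inside-holds = FinP.∀-cons q0 inside-holds ; outside-fails = outside-fails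
  ; inside-injective = zero∷suc∘-injective inside-injective
  ; outside-injective = suc∘-injective outside-injective }
  where open Partition P
... | P | no ¬q0 = record
  { #in = #in ; #out = suc #out ; #in+#out≡n = trans (ℕP.+-suc #in #out) (cong suc #in+#out≡n)
  ; inside = Fin.suc ∘ inside ; outside = Fin.zero ∷ Fin.suc ∘ outside
  ; inside-holds = inside-holds ; outside-fails = FinP.∀-cons ¬q0 outside-fails
  ; inside-injective = suc∘-injective inside-injective
  ; outside-injective = zero∷suc∘-injective outside-injective }
  where open Partition P

lookup-tabulate-cast : ∀ {a} {A : Set a} {n} (f : Fin n → A) i →
                  lookup (tabulate f) i ≡ f (cast (ListP.length-tabulate f) i)
lookup-tabulate-cast f i = begin
  lookup (tabulate f) i ≡⟨ cong (lookup (tabulate f)) (FinP.cast-involutive _ (ListP.length-tabulate f) i) ⟨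
  lookup (tabulate f) (cast _ (cast (ListP.length-tabulate f) i)) ≡⟨ ListP.lookup-tabulate f _ ⟩
  f (cast (ListP.length-tabulate f) i) ∎
  where open ≡-Reasoning

record Remainder {a} {A : Set a} (C : List A) {m} (hit : Fin m → Fin (length C)) : Set a where
  field
    rest            : List A
    index           : Fin (length rest) → Fin (length C)
    index-injective : Injective _≡_ _≡_ index
    index-missed    : ∀ i j → hit j ≢ index i
    lookup-rest     : ∀ i → lookup rest i ≡ lookup C (index i)
    length-bound    : length C ≤ m ℕ.+ length rest

  rest-all : ∀ {ℓ} (P : A → Set ℓ) → (∀ i → P (lookup C (index i))) → ∀ i → P (lookup rest i)
  rest-all P P-index i = subst P (sym (lookup-rest i)) (P-index i)

remainder : ∀ {a} {A : Set a} (C : List A) {m} (hit : Fin m → Fin (length C)) → Remainder C hit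
remainder C {m} hit = record
  { rest            = tabulate (lookup C ∘ outside)
  ; index           = index
  ; index-injective = λ eq → cast-injective length-rest (outside-injective eq)
  ; index-missed    = λ i j eq → outside-fails (cast length-rest i) (j , eq)
  ; lookup-rest     = lookup-tabulate-cast (lookup C ∘ outside)
  ; length-bound    = begin
      length C          ≡⟨ #in+#out≡n ⟨
      #in ℕ.+ #out      ≤⟨ ℕP.+-monoˡ-≤ #out #in≤m ⟩
      m ℕ.+ #out        ≡⟨ cong (m ℕ.+_) length-rest ⟨
      m ℕ.+ length (tabulate (lookup C ∘ outside)) ∎
  }
  where
  open Partition (partition (λ i → FinP.any? (λ j → hit j FinP.≟ i)))
  length-rest : length (tabulate (lookup C ∘ outside)) ≡ #out
  length-rest = ListP.length-tabulate (lookup C ∘ outside)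
  index : Fin (length (tabulate (lookup C ∘ outside))) → Fin (length C)
  index = outside ∘ cast length-rest
  preimage : Fin #in → Fin m
  preimage i = proj₁ (inside-holds i)
  #in≤m : #in ≤ m
  #in≤m = FinP.injective⇒≤ {f = preimage} λ {i} {j} eq → inside-injective (begin
    inside i          ≡⟨ proj₂ (inside-holds i) ⟨
    hit (preimage i)  ≡⟨ cong hit eq ⟩
    hit (preimage j)  ≡⟨ proj₂ (inside-holds j) ⟩
    inside j          ∎)
    where open ≡-Reasoning
  open ℕP.≤-Reasoning

all-++ : ∀ {a} {A : Set a} {m n} (P : A → Set) {f : Fin m → A} {g : Fin n → A} →
         (∀ i → P (f i)) → (∀ i → P (g i)) → ∀ i → P ((f ++ g) i)
all-++ {m = m} P Pf Pg i with splitAt m i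
... | inj₁ i′ = Pf i′
... | inj₂ i′ = Pg i′

module LinearAlgebra {q : ℕ} (F : FiniteField q) where
  open FiniteField F
  open LinAlg F

  commutativeRing : CommutativeRing _ _
  commutativeRing = record { isCommutativeRing = isCommutativeRing }

  open CommutativeRing commutativeRing public
    using ( +-assoc; +-comm; +-identityˡ; +-identityʳ; -‿inverseˡ; -‿inverseʳ; *-assoc; *-comm
          ; *-identityˡ; *-identityʳ; distribˡ; distribʳ; zeroˡ; zeroʳ; ring; semiring
          ; +-group; +-abelianGroup )
  open import Algebra.Properties.Ring ring using (-‿distribˡ-*; -‿distribʳ-*; -1*x≈-x)
  open import Algebra.Properties.Group +-group using (ε⁻¹≈ε; ⁻¹-involutive; inverseʳ-unique)
  open import Algebra.Properties.AbelianGroup +-abelianGroup using (⁻¹-∙-comm; xyx⁻¹≈y)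
  open import Algebra.Properties.Semiring.Sum semiring public
    using (sum; sum-cong-≗; ∑-distrib-+; *-distribˡ-sum; sum-replicate-zero; sum-remove)
  open ≡-Reasoning

  carrierEncoding : Encoding _≡_ q
  carrierEncoding = record
    { isEquivalence = ≡-isEquivalence
    ; encode        = Inverse.from enumeration
    ; decode        = Inverse.to enumeration
    ; decode-encode = Inverse.strictlyInverseˡ enumeration
    ; encode-cong   = cong (Inverse.from enumeration)
    }

  open Encoding carrierEncoding public using (_≟_)

  pointEncoding : ∀ n → Encoding (_≈_ {n}) (q ^ n)
  pointEncoding = vectorEncoding carrierEncoding

  ⁻¹-cancelˡ : ∀ {b} z → b ≢ 0# → b ⁻¹ * (b * z) ≡ z
  ⁻¹-cancelˡ {b} z b≢0 = begin
    b ⁻¹ * (b * z) ≡⟨ *-assoc _ _ _ ⟨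
    b ⁻¹ * b * z   ≡⟨ cong (_* z) (trans (*-comm _ _) (⁻¹-inverse b b≢0)) ⟩
    1# * z         ≡⟨ *-identityˡ z ⟩
    z              ∎

  -‿*-‿ : ∀ a b → - a * - b ≡ a * b
  -‿*-‿ a b = begin
    - a * - b     ≡⟨ -‿distribˡ-* a (- b) ⟨
    - (a * - b)   ≡⟨ cong -_ (-‿distribʳ-* a b) ⟨
    - - (a * b)   ≡⟨ ⁻¹-involutive _ ⟩
    a * b         ∎

  sum-neg : ∀ {n} (f : Fin n → Carrier) → sum (λ i → - f i) ≡ - sum f
  sum-neg {zero}  f = sym ε⁻¹≈ε
  sum-neg {suc n} f = trans (cong (- head f +_) (sum-neg (tail f))) (⁻¹-∙-comm _ _)

  sum-split : ∀ {m n} (f : Fin (m ℕ.+ n) → Carrier) →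
              sum f ≡ sum (λ i → f (i ↑ˡ n)) + sum (λ i → f (m ↑ʳ i))
  sum-split {zero}  f = sym (+-identityˡ _)
  sum-split {suc m} f = trans (cong (head f +_) (sum-split {m} (tail f))) (sym (+-assoc _ _ _))

  sum-δʳ : ∀ {n} (c : Fin n → Carrier) t → sum (λ s → c s * identity s t) ≡ c t
  sum-δʳ {suc n} c Fin.zero = begin
    c Fin.zero * 1# + sum (λ s → c (Fin.suc s) * 0#)
      ≡⟨ cong₂ _+_ (*-identityʳ _) (trans (sum-cong-≗ {n} (λ s → zeroʳ (c (Fin.suc s)))) (sum-replicate-zero n)) ⟩
    c Fin.zero + 0# ≡⟨ +-identityʳ _ ⟩
    c Fin.zero      ∎
  sum-δʳ {suc n} c (Fin.suc t) = begin
    c Fin.zero * 0# + sum (λ s → c (Fin.suc s) * identity (Fin.suc s) (Fin.suc t))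
      ≡⟨ cong₂ _+_ (zeroʳ _) (sum-δʳ (tail c) t) ⟩
    0# + c (Fin.suc t) ≡⟨ +-identityˡ _ ⟩
    c (Fin.suc t)      ∎

  identity-sym : ∀ {n} (s t : Fin n) → identity s t ≡ identity t s
  identity-sym s t with s FinP.≟ t | t FinP.≟ s
  ... | yes _   | yes _   = refl
  ... | no  _   | no  _   = refl
  ... | yes s≡t | no t≢s  = ⊥-elim (t≢s (sym s≡t))
  ... | no  s≢t | yes t≡s = ⊥-elim (s≢t (sym t≡s))

  sum-δˡ : ∀ {n} (c : Fin n → Carrier) t → sum (λ s → identity t s * c s) ≡ c t
  sum-δˡ c t = trans (sum-cong-≗ (λ s → trans (*-comm _ _) (cong (c s *_) (identity-sym t s)))) (sum-δʳ c t)

  ≈-refl : ∀ {n} {x : Pt n} → x ≈ x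
  ≈-refl _ = refl

  ≈-sym : ∀ {n} {x y : Pt n} → x ≈ y → y ≈ x
  ≈-sym x≈y i = sym (x≈y i)

  ≈-trans : ∀ {n} {x y z : Pt n} → x ≈ y → y ≈ z → x ≈ z
  ≈-trans x≈y y≈z i = trans (x≈y i) (y≈z i)

  ≡⇒≈ : ∀ {n} {x y : Pt n} → x ≡ y → x ≈ y
  ≡⇒≈ refl = ≈-refl

  negV : ∀ {n} → Pt n → Pt n
  negV x i = - x i

  ∑-pointwise : ∀ {m n} (f : Fin m → Pt n) p → ∑ f p ≡ sum (λ i → f i p)
  ∑-pointwise {zero}  f p = refl
  ∑-pointwise {suc m} f p = cong (f Fin.zero p +_) (∑-pointwise (tail f) p)

  linComb-pointwise : ∀ {m n} (c : Fin m → Carrier) (b : Fin m → Pt n) p →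
                      linComb c b p ≡ sum (λ i → c i * b i p)
  linComb-pointwise c b = ∑-pointwise (λ i → c i · b i)

  linComb-cong : ∀ {m n} {c c′ : Fin m → Carrier} {b b′ : Fin m → Pt n} →
                 (∀ i p → c i * b i p ≡ c′ i * b′ i p) → linComb c b ≈ linComb c′ b′
  linComb-cong {c = c} {c′} {b} {b′} eq p = begin
    linComb c b p             ≡⟨ linComb-pointwise c b p ⟩
    sum (λ i → c i * b i p)   ≡⟨ sum-cong-≗ (λ i → eq i p) ⟩
    sum (λ i → c′ i * b′ i p) ≡⟨ linComb-pointwise c′ b′ p ⟨
    linComb c′ b′ p           ∎

  linComb-congˡ : ∀ {m n} {c c′ : Fin m → Carrier} (b : Fin m → Pt n) →
                  (∀ i → c i ≡ c′ i) → linComb c b ≈ linComb c′ b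
  linComb-congˡ b eq = linComb-cong (λ i p → cong (_* b i p) (eq i))

  linComb-congʳ : ∀ {m n} (c : Fin m → Carrier) {b b′ : Fin m → Pt n} →
                  (∀ i → b i ≈ b′ i) → linComb c b ≈ linComb c b′
  linComb-congʳ c eq = linComb-cong (λ i p → cong (c i *_) (eq i p))

  linComb-zero : ∀ {m n} (b : Fin m → Pt n) → linComb (λ _ → 0#) b ≈ zeroV
  linComb-zero {m} b p = begin
    linComb (λ _ → 0#) b p   ≡⟨ linComb-pointwise _ b p ⟩
    sum (λ i → 0# * b i p)   ≡⟨ sum-cong-≗ (λ i → zeroˡ (b i p)) ⟩
    sum {m} (λ _ → 0#)       ≡⟨ sum-replicate-zero m ⟩
    0#                       ∎

  linComb-+ : ∀ {m n} (c c′ : Fin m → Carrier) (b : Fin m → Pt n) →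
              linComb (λ i → c i + c′ i) b ≈ (linComb c b ⊕ linComb c′ b)
  linComb-+ c c′ b p = begin
    linComb (λ i → c i + c′ i) b p                      ≡⟨ linComb-pointwise (λ i → c i + c′ i) b p ⟩
    sum (λ i → (c i + c′ i) * b i p)                    ≡⟨ sum-cong-≗ (λ i → distribʳ (b i p) (c i) (c′ i)) ⟩
    sum (λ i → c i * b i p + c′ i * b i p)              ≡⟨ ∑-distrib-+ (λ i → c i * b i p) (λ i → c′ i * b i p) ⟩
    sum (λ i → c i * b i p) + sum (λ i → c′ i * b i p)
      ≡⟨ cong₂ _+_ (linComb-pointwise c b p) (linComb-pointwise c′ b p) ⟨
    linComb c b p + linComb c′ b p                      ∎

  linComb-* : ∀ {m n} a (c : Fin m → Carrier) (b : Fin m → Pt n) →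
              linComb (λ i → a * c i) b ≈ (a · linComb c b)
  linComb-* a c b p = begin
    linComb (λ i → a * c i) b p      ≡⟨ linComb-pointwise (λ i → a * c i) b p ⟩
    sum (λ i → a * c i * b i p)      ≡⟨ sum-cong-≗ (λ i → *-assoc a (c i) (b i p)) ⟩
    sum (λ i → a * (c i * b i p))    ≡⟨ *-distribˡ-sum a (λ i → c i * b i p) ⟨
    a * sum (λ i → c i * b i p)      ≡⟨ cong (a *_) (linComb-pointwise c b p) ⟨
    a * linComb c b p                ∎

  linComb-difference : ∀ {r m} (c : Fin r → Carrier) (A B : Mat r m) →
               linComb c (A -ᴹ B) ≈ (linComb c A ⊕ negV (linComb c B))
  linComb-difference c A B p = begin
    linComb c (A -ᴹ B) p                                  ≡⟨ linComb-pointwise c (A -ᴹ B) p ⟩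
    sum (λ i → c i * (A i p + - B i p))                   ≡⟨ sum-cong-≗ (λ i → distribˡ (c i) (A i p) (- B i p)) ⟩
    sum (λ i → c i * A i p + c i * - B i p)               ≡⟨ ∑-distrib-+ (λ i → c i * A i p) (λ i → c i * - B i p) ⟩
    sum (λ i → c i * A i p) + sum (λ i → c i * - B i p)   ≡⟨ cong (sum (λ i → c i * A i p) +_)
                                                              (sum-cong-≗ (λ i → -‿distribʳ-* (c i) (B i p))) ⟨
    sum (λ i → c i * A i p) + sum (λ i → - (c i * B i p)) ≡⟨ cong₂ _+_ (sym (linComb-pointwise c A p))
                                                              (trans (sum-neg (λ i → c i * B i p)) (cong -_ (sym (linComb-pointwise c B p)))) ⟩
    linComb c A p + - linComb c B p                       ∎

  linComb-split : ∀ {m m′ n} (c : Fin (m ℕ.+ m′) → Carrier) (u : Fin (m ℕ.+ m′) → Pt n) →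
                  linComb c u ≈ (linComb (λ i → c (i ↑ˡ m′)) (λ i → u (i ↑ˡ m′)) ⊕
                                 linComb (λ i → c (m ↑ʳ i)) (λ i → u (m ↑ʳ i)))
  linComb-split {m} {m′} c u p = begin
    linComb c u p                                                   ≡⟨ linComb-pointwise c u p ⟩
    sum (λ i → c i * u i p)                                         ≡⟨ sum-split {m} (λ i → c i * u i p) ⟩
    sum (λ i → c (i ↑ˡ m′) * u (i ↑ˡ m′) p) + sum (λ i → c (m ↑ʳ i) * u (m ↑ʳ i) p)
      ≡⟨ cong₂ _+_ (linComb-pointwise (λ i → c (i ↑ˡ m′)) (λ i → u (i ↑ˡ m′)) p)
                   (linComb-pointwise (λ i → c (m ↑ʳ i)) (λ i → u (m ↑ʳ i)) p) ⟨
    linComb (λ i → c (i ↑ˡ m′)) (λ i → u (i ↑ˡ m′)) p + linComb (λ i → c (m ↑ʳ i)) (λ i → u (m ↑ʳ i)) p ∎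

  linComb-++ : ∀ {m m′ n} (c : Fin (m ℕ.+ m′) → Carrier) (f : Fin m → Pt n) (g : Fin m′ → Pt n) →
               linComb c (f ++ g) ≈ (linComb (λ i → c (i ↑ˡ m′)) f ⊕ linComb (λ i → c (m ↑ʳ i)) g)
  linComb-++ {m} {m′} c f g p = trans (linComb-split {m} c (f ++ g) p)
    (cong₂ _+_ (linComb-congʳ _ (λ i → ≡⇒≈ (lookup-++ˡ f g i)) p)
               (linComb-congʳ _ (λ i → ≡⇒≈ (lookup-++ʳ f g i)) p))

  linComb-removeAt : ∀ {m n} (c : Fin (suc m) → Carrier) (b : Fin (suc m) → Pt n) j →
                     linComb c b ≈ ((c j · b j) ⊕ linComb (c ∘ punchIn j) (b ∘ punchIn j))
  linComb-removeAt c b j p = begin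
    linComb c b p                                               ≡⟨ linComb-pointwise c b p ⟩
    sum (λ i → c i * b i p)                                     ≡⟨ sum-remove {i = j} (λ i → c i * b i p) ⟩
    c j * b j p + sum (λ i → c (punchIn j i) * b (punchIn j i) p)
      ≡⟨ cong (c j * b j p +_) (linComb-pointwise (c ∘ punchIn j) (b ∘ punchIn j) p) ⟨
    c j * b j p + linComb (c ∘ punchIn j) (b ∘ punchIn j) p     ∎

  linComb-restrict : ∀ {m n n′} (g : Fin n′ → Fin n) (c : Fin m → Carrier) (b : Fin m → Pt n) →
                     (linComb c b ∘ g) ≈ linComb c (λ i → b i ∘ g)
  linComb-restrict g c b p = trans (linComb-pointwise c b (g p)) (sym (linComb-pointwise c _ p))

  linComb-identity : ∀ {n} (x : Pt n) → x ≈ linComb x identity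
  linComb-identity x p = sym (trans (linComb-pointwise x identity p) (sum-δʳ x p))

  linComb-δ : ∀ {m n} (b : Fin m → Pt n) i → b i ≈ linComb (identity i) b
  linComb-δ b i p = sym (trans (linComb-pointwise _ b p) (sum-δˡ (λ s → b s p) i))

  identity-≢ : ∀ {n} {i j : Fin n} → i ≢ j → identity i j ≡ 0#
  identity-≢ {i = i} {j} i≢j with i FinP.≟ j
  ... | yes i≡j = ⊥-elim (i≢j i≡j)
  ... | no  _   = refl

  identity-∘ : ∀ {n n′} {g : Fin n → Fin n′} → Injective _≡_ _≡_ g → ∀ s t → identity (g s) (g t) ≡ identity s t
  identity-∘ {g = g} g-inj s t with s FinP.≟ t | g s FinP.≟ g t
  ... | yes _   | yes _     = refl
  ... | no  _   | no  _     = refl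
  ... | yes s≡t | no gs≢gt  = ⊥-elim (gs≢gt (cong g s≡t))
  ... | no  s≢t | yes gs≡gt = ⊥-elim (s≢t (g-inj gs≡gt))

  _⊆_ : ∀ {n} → VSet n → VSet n → Set
  U ⊆ W = ∀ {x} → U x → W x

  module _ {n} {U : VSet n} (U-sub : IsSubspace U) where
    open IsSubspace U-sub

    neg-mem : ∀ {x} → U x → U (negV x)
    neg-mem x∈U = respects (λ i → -1*x≈-x _) (scale-mem (- 1#) x∈U)

    linComb-mem : ∀ {m} (b : Fin m → Pt n) → (∀ i → U (b i)) → ∀ c → U (linComb c b)
    linComb-mem {zero}  b b∈U c = zero-mem
    linComb-mem {suc m} b b∈U c =
      add-mem (scale-mem (head c) (b∈U Fin.zero)) (linComb-mem (tail b) (b∈U ∘ Fin.suc) (tail c))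

    rowspace⊆ : ∀ {m} (b : Fin m → Pt n) → (∀ i → U (b i)) → rowspace b ⊆ U
    rowspace⊆ b b∈U (c , x≈) = respects (≈-sym x≈) (linComb-mem b b∈U c)

    ⊕-cancelˡ-mem : ∀ {y z} → U (y ⊕ z) → U y → U z
    ⊕-cancelˡ-mem {y} y+z∈U y∈U = respects (λ i → xyx⁻¹≈y (y i) _) (add-mem y+z∈U (neg-mem y∈U))

    ⊕-cancelʳ-mem : ∀ {y z} → U (y ⊕ z) → U z → U y
    ⊕-cancelʳ-mem y+z∈U = ⊕-cancelˡ-mem (respects (λ i → +-comm _ _) y+z∈U)

    ·-cancel-mem : ∀ {b x} → b ≢ 0# → U (b · x) → U x
    ·-cancel-mem {b} b≢0 bx∈U = respects (λ i → ⁻¹-cancelˡ _ b≢0) (scale-mem (b ⁻¹) bx∈U)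

  ∩ˢ-isSubspace : ∀ {n} {U V : VSet n} → IsSubspace U → IsSubspace V → IsSubspace (U ∩ˢ V)
  ∩ˢ-isSubspace U-sub V-sub = record
    { respects  = λ x≈y (x∈U , x∈V) → U.respects x≈y x∈U , V.respects x≈y x∈V
    ; zero-mem  = U.zero-mem , V.zero-mem
    ; add-mem   = λ (x∈U , x∈V) (y∈U , y∈V) → U.add-mem x∈U y∈U , V.add-mem x∈V y∈V
    ; scale-mem = λ a (x∈U , x∈V) → U.scale-mem a x∈U , V.scale-mem a x∈V
    }
    where
    module U = IsSubspace U-sub
    module V = IsSubspace V-sub

  rowspace-isSubspace : ∀ {m n} (b : Fin m → Pt n) → IsSubspace (rowspace b)
  rowspace-isSubspace b = record
    { respects  = λ { x≈y (c , x≈) → c , ≈-trans (≈-sym x≈y) x≈ }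
    ; zero-mem  = (λ _ → 0#) , ≈-sym (linComb-zero b)
    ; add-mem   = λ { (c , x≈) (c′ , y≈) → (λ i → c i + c′ i) ,
                      ≈-trans (λ p → cong₂ _+_ (x≈ p) (y≈ p)) (≈-sym (linComb-+ c c′ b)) }
    ; scale-mem = λ { a (c , x≈) → (λ i → a * c i) , ≈-trans (λ p → cong (a *_) (x≈ p)) (≈-sym (linComb-* a c b)) }
    }

  rowspace-gen : ∀ {m n} (b : Fin m → Pt n) i → rowspace b (b i)
  rowspace-gen b i = identity i , linComb-δ b i

  rowspace-full : ∀ {n} (x : Pt n) → rowspace identity x
  rowspace-full x = x , linComb-identity x

  rowspace-mono : ∀ {m m′ n} {b : Fin m → Pt n} (w : Fin m′ → Pt n) →
                  (∀ i → rowspace w (b i)) → rowspace b ⊆ rowspace w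
  rowspace-mono w = rowspace⊆ (rowspace-isSubspace w) _

  rowspace-++ˡ-gen : ∀ {m m′ n} (f : Fin m → Pt n) (g : Fin m′ → Pt n) i → rowspace (f ++ g) (f i)
  rowspace-++ˡ-gen {m′ = m′} f g i = subst (rowspace (f ++ g)) (lookup-++ˡ f g i) (rowspace-gen (f ++ g) (i ↑ˡ m′))

  rowspace-++ʳ-gen : ∀ {m m′ n} (f : Fin m → Pt n) (g : Fin m′ → Pt n) i → rowspace (f ++ g) (g i)
  rowspace-++ʳ-gen {m} f g i = subst (rowspace (f ++ g)) (lookup-++ʳ f g i) (rowspace-gen (f ++ g) (m ↑ʳ i))

  rowspace-++ˡ : ∀ {m m′ n} (f : Fin m → Pt n) (g : Fin m′ → Pt n) → rowspace f ⊆ rowspace (f ++ g)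
  rowspace-++ˡ f g = rowspace-mono (f ++ g) (rowspace-++ˡ-gen f g)

  rowspace-++ʳ : ∀ {m m′ n} (f : Fin m → Pt n) (g : Fin m′ → Pt n) → rowspace g ⊆ rowspace (f ++ g)
  rowspace-++ʳ f g = rowspace-mono (f ++ g) (rowspace-++ʳ-gen f g)

  rowspace? : ∀ {m n} (b : Fin m → Pt n) x → Dec (rowspace b x)
  rowspace? {m} b x = Encoding.any? (pointEncoding m) (λ c → x ≈ linComb c b)
    (λ c → Pointwise.decidable _≟_ x (linComb c b)) (λ c≈c′ x≈ → ≈-trans x≈ (linComb-congˡ b c≈c′))

  LinIndep-tail : ∀ {m n} {u : Fin (suc m) → Pt n} → LinIndep u → LinIndep (tail u)
  LinIndep-tail {u = u} ind c dep i = ind (0# ∷ c) dep′ (Fin.suc i)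
    where
    dep′ : linComb (0# ∷ c) u ≈ zeroV
    dep′ p = trans (cong (_+ linComb c (tail u) p) (zeroˡ _)) (trans (+-identityˡ _) (dep p))

  LinIndep-↑ˡ : ∀ {m m′ n} {u : Fin (m ℕ.+ m′) → Pt n} → LinIndep u → LinIndep (λ i → u (i ↑ˡ m′))
  LinIndep-↑ˡ {m} {m′} {u = u} ind c dep i = trans (sym (lookup-++ˡ c zeros i)) (ind (c ++ zeros) dep′ (i ↑ˡ m′))
    where
    zeros : Fin m′ → Carrier
    zeros _ = 0#
    dep′ : linComb (c ++ zeros) u ≈ zeroV
    dep′ p = begin
      linComb (c ++ zeros) u p
        ≡⟨ linComb-split {m} (c ++ zeros) u p ⟩
      linComb (λ i → (c ++ zeros) (i ↑ˡ m′)) (λ i → u (i ↑ˡ m′)) p +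
      linComb (λ i → (c ++ zeros) (m ↑ʳ i)) (λ i → u (m ↑ʳ i)) p
        ≡⟨ cong₂ _+_ (trans (linComb-congˡ _ (lookup-++ˡ c zeros) p) (dep p))
                     (trans (linComb-congˡ _ (lookup-++ʳ c zeros) p) (linComb-zero (λ i → u (m ↑ʳ i)) p)) ⟩
      0# + 0#
        ≡⟨ +-identityˡ 0# ⟩
      0# ∎

  LinIndep-restrict : ∀ {m n n′} (g : Fin n′ → Fin n) {u : Fin m → Pt n} → LinIndep (λ i → u i ∘ g) → LinIndep u
  LinIndep-restrict g {u} ind c dep = ind c (λ p → trans (sym (linComb-restrict g c u p)) (dep (g p)))

  identity-indep : ∀ {n} → LinIndep (identity {n})
  identity-indep c dep i = trans (linComb-identity c i) (dep i)

  LinIndep-resp : ∀ {m n} {u u′ : Fin m → Pt n} → (∀ i → u i ≈ u′ i) → LinIndep u → LinIndep u′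
  LinIndep-resp u≈u′ ind c dep = ind c (≈-trans (linComb-congʳ c u≈u′) dep)

  head∉rowspace-tail : ∀ {m n} {u : Fin (suc m) → Pt n} → LinIndep u → ¬ rowspace (tail u) (head u)
  head∉rowspace-tail {u = u} ind (a , u₀≈) = 0≢1 (begin
    0#      ≡⟨ ε⁻¹≈ε ⟨
    - 0#    ≡⟨ cong -_ (ind (- 1# ∷ a) dep Fin.zero) ⟨
    - - 1#  ≡⟨ ⁻¹-involutive 1# ⟩
    1#      ∎)
    where
    dep : linComb (- 1# ∷ a) u ≈ zeroV
    dep p = begin
      - 1# * head u p + linComb a (tail u) p ≡⟨ cong₂ _+_ (-1*x≈-x _) (sym (u₀≈ p)) ⟩
      - head u p + head u p                  ≡⟨ -‿inverseˡ _ ⟩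
      0#                                     ∎

  LinIndep-∷ : ∀ {m n} {x : Pt n} {b : Fin m → Pt n} → LinIndep b → ¬ rowspace b x → LinIndep (x ∷ b)
  LinIndep-∷ {x = x} {b} ind x∉b c dep with head c ≟ 0#
  ... | yes c₀≡0 = FinP.∀-cons c₀≡0 (ind (tail c) tail-dep)
    where
    tail-dep : linComb (tail c) b ≈ zeroV
    tail-dep p = begin
      linComb (tail c) b p                     ≡⟨ +-identityˡ _ ⟨
      0# + linComb (tail c) b p                ≡⟨ cong (_+ linComb (tail c) b p) (trans (cong (_* x p) c₀≡0) (zeroˡ (x p))) ⟨
      head c * x p + linComb (tail c) b p      ≡⟨ dep p ⟩
      0#                                       ∎
  ... | no c₀≢0 = ⊥-elim (x∉b ((λ i → - (head c ⁻¹) * tail c i) , x≈))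
    where
    x≈ : x ≈ linComb (λ i → - (head c ⁻¹) * tail c i) b
    x≈ p = begin
      x p                                       ≡⟨ ⁻¹-cancelˡ (x p) c₀≢0 ⟨
      head c ⁻¹ * (head c * x p)                ≡⟨ -‿*-‿ _ _ ⟨
      - (head c ⁻¹) * - (head c * x p)          ≡⟨ cong (- (head c ⁻¹) *_) (inverseʳ-unique _ _ (dep p)) ⟨
      - (head c ⁻¹) * linComb (tail c) b p      ≡⟨ linComb-* (- (head c ⁻¹)) (tail c) b p ⟨
      linComb (λ i → - (head c ⁻¹) * tail c i) b p ∎

  -- z′ j, whose coefficient in head u is non-zero, is traded for head u.
  steinitz-replace : ∀ {m m′ n} (u : Fin (suc m) → Pt n) (z′ : Fin m′ → Pt n) (a : Fin m → Carrier)
            (b : Fin m′ → Carrier) j → b j ≢ 0# → head u ≈ (linComb a (tail u) ⊕ linComb b z′) →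
            ∃ λ k → suc k ≡ m′ × Σ (Fin k → Pt n) λ z → rowspace (tail u ++ z′) ⊆ rowspace (u ++ z)
  steinitz-replace {m′ = suc k} {n} u z′ a b j bⱼ≢0 u₀≈ =
    k , refl , z , rowspace⊆ T-sub (tail u ++ z′) (all-++ T (u-in ∘ Fin.suc) z′-in)
    where
    z : Fin k → Pt n
    z = z′ ∘ punchIn j
    T : VSet n
    T = rowspace (u ++ z)
    T-sub : IsSubspace T
    T-sub = rowspace-isSubspace (u ++ z)
    u-in : ∀ i → T (u i)
    u-in = rowspace-++ˡ-gen u z
    z-in : ∀ i → T (z i)
    z-in = rowspace-++ʳ-gen u z
    X Y : Pt n
    X = linComb a (tail u)
    Y = linComb (b ∘ punchIn j) z
    u₀≈XbzY : head u ≈ (X ⊕ ((b j · z′ j) ⊕ Y))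
    u₀≈XbzY p = trans (u₀≈ p) (cong (X p +_) (linComb-removeAt b z′ j p))
    z′ⱼ-in : T (z′ j)
    z′ⱼ-in = ·-cancel-mem T-sub bⱼ≢0
      (⊕-cancelʳ-mem T-sub
        (⊕-cancelˡ-mem T-sub (IsSubspace.respects T-sub u₀≈XbzY (u-in Fin.zero))
          (linComb-mem T-sub (tail u) (u-in ∘ Fin.suc) a))
        (linComb-mem T-sub z z-in (b ∘ punchIn j)))
    z′-in : ∀ i → T (z′ i)
    z′-in i with j FinP.≟ i
    ... | yes refl = z′ⱼ-in
    ... | no j≢i   = subst T (cong z′ (FinP.punchIn-punchOut j≢i)) (z-in (punchOut j≢i))

  steinitz-step : ∀ {m m′ n} (u : Fin (suc m) → Pt n) (z′ : Fin m′ → Pt n) → LinIndep u →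
                  rowspace (tail u ++ z′) (head u) →
                  ∃ λ m″ → suc m″ ≡ m′ × Σ (Fin m″ → Pt n) λ z → rowspace (tail u ++ z′) ⊆ rowspace (u ++ z)
  steinitz-step {m} u z′ ind (c , u₀≈) with FinP.any? (λ j → ¬? (c (m ↑ʳ j) ≟ 0#))
  ... | yes (j , bⱼ≢0) = steinitz-replace u z′ _ _ j bⱼ≢0 (≈-trans u₀≈ (linComb-++ c (tail u) z′))
  ... | no none = ⊥-elim (head∉rowspace-tail {u = u} ind ((λ i → c (i ↑ˡ _)) , u₀≈X))
    where
    bᵢ≡0 : ∀ j → c (m ↑ʳ j) ≡ 0#
    bᵢ≡0 j = decidable-stable (c (m ↑ʳ j) ≟ 0#) (λ bⱼ≢0 → none (j , bⱼ≢0))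
    u₀≈X : head u ≈ linComb (λ i → c (i ↑ˡ _)) (tail u)
    u₀≈X p = begin
      head u p ≡⟨ u₀≈ p ⟩
      linComb c (tail u ++ z′) p ≡⟨ linComb-++ c (tail u) z′ p ⟩
      linComb (λ i → c (i ↑ˡ _)) (tail u) p + linComb (λ j → c (m ↑ʳ j)) z′ p
        ≡⟨ cong (linComb (λ i → c (i ↑ˡ _)) (tail u) p +_) (trans (linComb-congˡ z′ bᵢ≡0 p) (linComb-zero z′ p)) ⟩
      linComb (λ i → c (i ↑ˡ _)) (tail u) p + 0# ≡⟨ +-identityʳ _ ⟩
      linComb (λ i → c (i ↑ˡ _)) (tail u) p ∎

  steinitz-exchange : ∀ {m m′ n} (u : Fin m → Pt n) (w : Fin m′ → Pt n) → LinIndep u →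
                      (∀ i → rowspace w (u i)) →
                      ∃ λ k → m ℕ.+ k ≡ m′ × Σ (Fin k → Pt n) λ z → rowspace w ⊆ rowspace (u ++ z)
  steinitz-exchange {zero} {m′} u w _ _ = m′ , refl , w , rowspace-++ʳ u w
  steinitz-exchange {suc m} u w ind u∈w
    with steinitz-exchange (tail u) w (LinIndep-tail {u = u} ind) (u∈w ∘ Fin.suc)
  ... | k′ , m+k′≡m′ , z′ , w⊆ with steinitz-step u z′ ind (w⊆ (u∈w Fin.zero))
  ... | k , 1+k≡k′ , z , ⊆u++z =
    k , trans (sym (ℕP.+-suc m k)) (trans (cong (m ℕ.+_) 1+k≡k′) m+k′≡m′) , z , λ x∈w → ⊆u++z (w⊆ x∈w)

  steinitz : ∀ {m m′ n} (u : Fin m → Pt n) (w : Fin m′ → Pt n) → LinIndep u → (∀ i → rowspace w (u i)) → m ≤ m′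
  steinitz u w ind u∈w with steinitz-exchange u w ind u∈w
  ... | k , m+k≡m′ , _ = subst (_ ≤_) m+k≡m′ (ℕP.m≤m+n _ k)

  LinIndep⇒≤ : ∀ {m n} (u : Fin m → Pt n) → LinIndep u → m ≤ n
  LinIndep⇒≤ u ind = steinitz u identity ind (rowspace-full ∘ u)

  module _ {n} {S : VSet n} (S-sub : IsSubspace S) (S? : ∀ x → Dec (S x)) where
    open IsSubspace S-sub

    extend-basis : ∀ fuel {m} (b : Fin m → Pt n) → m ℕ.+ fuel ≡ n → (∀ i → S (b i)) → LinIndep b → ∃ (HasDim S)
    extend-basis fuel {m} b m+fuel≡n b∈S ind
      with Encoding.any? (pointEncoding n) (λ x → S x × ¬ rowspace b x) (λ x → S? x ×-dec ¬? (rowspace? b x))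
             (λ x≈y (x∈S , x∉b) → respects x≈y x∈S ,
                                    λ y∈b → x∉b (IsSubspace.respects (rowspace-isSubspace b) (≈-sym x≈y) y∈b))
    ... | no none = m , b , b∈S , ind , spans
      where
      spans : ∀ x → S x → ∃ λ c → x ≈ linComb c b
      spans x x∈S = decidable-stable (rowspace? b x) (λ x∉b → none (x , x∈S , x∉b))
    ... | yes (x , x∈S , x∉b) with fuel
    ...   | zero   = ⊥-elim (ℕP.<-irrefl (trans (sym (ℕP.+-identityʳ m)) m+fuel≡n)
                                         (LinIndep⇒≤ (x ∷ b) (LinIndep-∷ ind x∉b)))
    ...   | suc fuel′ = extend-basis fuel′ (x ∷ b) (trans (sym (ℕP.+-suc m fuel′)) m+fuel≡n)
                          (FinP.∀-cons x∈S b∈S) (LinIndep-∷ ind x∉b)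

    hasDim : ∃ (HasDim S)
    hasDim = extend-basis n (λ ()) refl (λ ()) (λ _ _ ())

  HasDim⇒dec : ∀ {k n} {U : VSet n} → IsSubspace U → HasDim U k → ∀ x → Dec (U x)
  HasDim⇒dec U-sub (β , β∈U , _ , β-spans) x =
    map′ (rowspace⊆ U-sub β β∈U) (β-spans x) (rowspace? β x)

  dim≤span : ∀ {a m n} {U : VSet n} (w : Fin m → Pt n) → HasDim U a → U ⊆ rowspace w → a ≤ m
  dim≤span w (β , β∈U , β-indep , _) U⊆w = steinitz β w β-indep (U⊆w ∘ β∈U)

  indep≤dim : ∀ {b r n} {U : VSet n} (u : Fin r → Pt n) → HasDim U b → LinIndep u → (∀ i → U (u i)) → r ≤ b
  indep≤dim u (β , _ , _ , β-spans) u-indep u∈U = steinitz u β u-indep (λ i → β-spans (u i) (u∈U i))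

  +ˢ-least : ∀ {n} {U V T : VSet n} → IsSubspace T → U ⊆ T → V ⊆ T → (U +ˢ V) ⊆ T
  +ˢ-least T-sub U⊆T V⊆T (x , y , x∈U , y∈V , z≈) =
    IsSubspace.respects T-sub (≈-sym z≈) (IsSubspace.add-mem T-sub (U⊆T x∈U) (V⊆T y∈V))

  linComb-preimage : ∀ {k n} (D : Fin k → Pt n) {U : VSet n} → IsSubspace U → IsSubspace (λ c → U (linComb c D))
  linComb-preimage D U-sub = record
    { respects  = λ c≈c′ → respects (linComb-congˡ D c≈c′)
    ; zero-mem  = respects (≈-sym (linComb-zero D)) zero-mem
    ; add-mem   = λ {c} {c′} cD∈U c′D∈U → respects (≈-sym (linComb-+ c c′ D)) (add-mem cD∈U c′D∈U)
    ; scale-mem = λ a {c} cD∈U → respects (≈-sym (linComb-* a c D)) (scale-mem a cD∈U)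
    }
    where open IsSubspace U-sub

  -- Rank–nullity for A - A′, whose left kernel contains the independent vectors P.
  rankDist+agree≤rows : ∀ {r k m δ} (P : Fin r → Pt k) → LinIndep P → (A A′ : Mat k m) →
                        RankDistAtLeast δ A A′ → (∀ a → linComb (P a) A ≈ linComb (P a) A′) → δ ℕ.+ r ≤ k
  rankDist+agree≤rows {r} {k} {m} {δ} P P-indep A A′ (ρ , dimρ , δ≤ρ) agree
    with steinitz-exchange P identity P-indep (rowspace-full ∘ P)
  ... | k′ , r+k′≡k , z , full⊆P++z =
    subst (δ ℕ.+ r ≤_) (trans (ℕP.+-comm k′ r) r+k′≡k) (ℕP.+-monoˡ-≤ r (ℕP.≤-trans δ≤ρ ρ≤k′))
    where
    D : Mat k m
    D = A -ᴹ A′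
    zD : Fin k′ → Pt m
    zD l = linComb (z l) D
    T : VSet k
    T c = rowspace zD (linComb c D)
    T-sub : IsSubspace T
    T-sub = linComb-preimage D (rowspace-isSubspace zD)
    PD≈0 : ∀ a → linComb (P a) D ≈ zeroV
    PD≈0 a p = trans (linComb-difference (P a) A A′ p)
                     (trans (cong (_+ - linComb (P a) A′ p) (agree a p)) (-‿inverseʳ _))
    P∈T : ∀ a → T (P a)
    P∈T a = IsSubspace.respects (rowspace-isSubspace zD) (≈-sym (PD≈0 a)) (IsSubspace.zero-mem (rowspace-isSubspace zD))
    ρ≤k′ : ρ ≤ k′
    ρ≤k′ = dim≤span zD dimρ λ (c , x≈) →
      IsSubspace.respects (rowspace-isSubspace zD) (≈-sym x≈)
        (rowspace⊆ T-sub (P ++ z) (all-++ T P∈T (rowspace-gen zD)) (full⊆P++z (rowspace-full c)))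

  DistAtLeast⇒d+2r≤2k : ∀ {n k r d} (U V : Subspace n) → HasDim (elems U) k → HasDim (elems V) k →
                        DistAtLeast d U V → (u : Fin r → Pt n) → LinIndep u →
                        (∀ i → elems U (u i)) → (∀ i → elems V (u i)) → d ℕ.+ (r ℕ.+ r) ≤ k ℕ.+ k
  DistAtLeast⇒d+2r≤2k {n} {k} {r} {d} U V (β , _ , _ , β-spans) (γ , _ , _ , γ-spans)
                      (a , b , dim-a , dim-b , d+b≤a) u u-indep u∈U u∈V
    with steinitz-exchange u β u-indep (λ i → β-spans (u i) (u∈U i))
       | steinitz-exchange u γ u-indep (λ i → γ-spans (u i) (u∈V i))
  ... | k₁ , r+k₁≡k , z₁ , β⊆u++z₁ | k₂ , r+k₂≡k , z₂ , γ⊆u++z₂ =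
    ℕP.≤-trans (ℕP.≤-reflexive (sym (ℕP.+-assoc d r r)))
               (ℕP.≤-trans (ℕP.+-monoˡ-≤ r d+r≤dim-w) (ℕP.≤-reflexive dim-w+r≡k+k))
    where
    w : Fin (r ℕ.+ k₁ ℕ.+ k₂) → Pt n
    w = (u ++ z₁) ++ z₂
    w-sub : IsSubspace (rowspace w)
    w-sub = rowspace-isSubspace w
    U⊆w : elems U ⊆ rowspace w
    U⊆w x∈U = rowspace-++ˡ (u ++ z₁) z₂ (β⊆u++z₁ (β-spans _ x∈U))
    V⊆w : elems V ⊆ rowspace w
    V⊆w x∈V = rowspace⊆ w-sub (u ++ z₂) (all-++ (rowspace w) (U⊆w ∘ u∈U) (rowspace-++ʳ-gen (u ++ z₁) z₂))
                (γ⊆u++z₂ (γ-spans _ x∈V))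
    a≤ : a ≤ r ℕ.+ k₁ ℕ.+ k₂
    a≤ = dim≤span w dim-a (+ˢ-least w-sub U⊆w V⊆w)
    r≤b : r ≤ b
    r≤b = indep≤dim u dim-b u-indep (λ i → u∈U i , u∈V i)
    d+r≤dim-w : d ℕ.+ r ≤ r ℕ.+ k₁ ℕ.+ k₂
    d+r≤dim-w = ℕP.≤-trans (ℕP.+-monoʳ-≤ d r≤b) (ℕP.≤-trans d+b≤a a≤)
    dim-w+r≡k+k : r ℕ.+ k₁ ℕ.+ k₂ ℕ.+ r ≡ k ℕ.+ k
    dim-w+r≡k+k = trans (ℕP.+-assoc (r ℕ.+ k₁) k₂ r) (cong₂ ℕ._+_ r+k₁≡k (trans (ℕP.+-comm k₂ r) r+k₂≡k))

module Coordinates {q : ℕ} (F : FiniteField q) {v k : ℕ} (k≤v : k ≤ v) where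
  open FiniteField F
  open LinAlg F
  open LinearAlgebra F
  open ≡-Reasoning

  m : ℕ
  m = v ∸ k

  k+m≡v : k ℕ.+ m ≡ v
  k+m≡v = ℕP.m+[n∸m]≡n k≤v

  ιˡ : Fin k → Fin v
  ιˡ a = cast k+m≡v (a ↑ˡ m)

  ιʳ : Fin m → Fin v
  ιʳ b = cast k+m≡v (k ↑ʳ b)

  ιʳ-injective : Injective _≡_ _≡_ ιʳ
  ιʳ-injective eq = FinP.↑ʳ-injective k _ _ (cast-injective k+m≡v eq)

  ιˡ≢ιʳ : ∀ a b → ιˡ a ≢ ιʳ b
  ιˡ≢ιʳ a b eq with trans (sym (FinP.splitAt-↑ˡ k a m))
                      (trans (cong (splitAt k) (cast-injective k+m≡v eq)) (FinP.splitAt-↑ʳ k m b))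
  ... | ()

  π : Pt v → Pt k
  π x = x ∘ ιˡ

  uncast : ∀ j → cast k+m≡v (cast (sym k+m≡v) j) ≡ j
  uncast = FinP.cast-involutive k+m≡v (sym k+m≡v)

  data Side (j : Fin v) : Set where
    left  : ∀ a → splitAt k (cast (sym k+m≡v) j) ≡ inj₁ a → j ≡ ιˡ a → Side j
    right : ∀ b → splitAt k (cast (sym k+m≡v) j) ≡ inj₂ b → j ≡ ιʳ b → Side j

  side : ∀ j → Side j
  side j with splitAt k (cast (sym k+m≡v) j) in eq
  ... | inj₁ a = left a eq (trans (sym (uncast j)) (cong (cast k+m≡v) (sym (FinP.splitAt⁻¹-↑ˡ eq))))
  ... | inj₂ b = right b eq (trans (sym (uncast j)) (cong (cast k+m≡v) (sym (FinP.splitAt⁻¹-↑ʳ eq))))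

  liftMat-entry : ∀ (A : Mat k m) s {j x} → splitAt k (cast (sym k+m≡v) j) ≡ x →
                  liftMat k≤v A s j ≡ [ identity s , A s ] x
  liftMat-entry A s {j} refl with splitAt k (cast (sym k+m≡v) j)
  ... | inj₁ _ = refl
  ... | inj₂ _ = refl

  liftMat-rowspace : (A : Mat k m) {c : Pt k} {y : Pt v} → π y ≈ c → (y ∘ ιʳ) ≈ linComb c A →
                     rowspace (liftMat k≤v A) y
  liftMat-rowspace A {c} {y} πy≈c y∘ιʳ≈cA = c , λ j → sym (trans (linComb-pointwise c (liftMat k≤v A) j) (entry j (side j)))
    where
    entry : ∀ j → Side j → sum (λ s → c s * liftMat k≤v A s j) ≡ y j
    entry j (left a split≡ j≡) = begin
      sum (λ s → c s * liftMat k≤v A s j) ≡⟨ sum-cong-≗ (λ s → cong (c s *_) (liftMat-entry A s split≡)) ⟩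
      sum (λ s → c s * identity s a)      ≡⟨ sum-δʳ c a ⟩
      c a                                 ≡⟨ πy≈c a ⟨
      y (ιˡ a)                            ≡⟨ cong y j≡ ⟨
      y j                                 ∎
    entry j (right b split≡ j≡) = begin
      sum (λ s → c s * liftMat k≤v A s j) ≡⟨ sum-cong-≗ (λ s → cong (c s *_) (liftMat-entry A s split≡)) ⟩
      sum (λ s → c s * A s b)             ≡⟨ linComb-pointwise c A b ⟨
      linComb c A b                       ≡⟨ y∘ιʳ≈cA b ⟨
      y (ιʳ b)                            ≡⟨ cong y j≡ ⟨
      y j                                 ∎

  W : VSet v
  W x = π x ≈ zeroV

  W-isSubspace : IsSubspace W
  W-isSubspace = record
    { respects  = λ x≈y x∈W a → trans (sym (x≈y (ιˡ a))) (x∈W a)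
    ; zero-mem  = λ _ → refl
    ; add-mem   = λ x∈W y∈W a → trans (cong₂ _+_ (x∈W a) (y∈W a)) (+-identityˡ 0#)
    ; scale-mem = λ c x∈W a → trans (cong (c *_) (x∈W a)) (zeroʳ c)
    }

  W? : ∀ x → Dec (W x)
  W? x = Pointwise.decidable _≟_ (π x) zeroV

  W-dim : HasDim W m
  W-dim = e , e∈W , e-indep , e-spans
    where
    e : Fin m → Pt v
    e b = identity (ιʳ b)
    e∈W : ∀ b → W (e b)
    e∈W b a = identity-≢ (λ eq → ιˡ≢ιʳ a b (sym eq))
    e-indep : LinIndep e
    e-indep = LinIndep-restrict ιʳ (LinIndep-resp (λ b b′ → sym (identity-∘ ιʳ-injective b b′)) identity-indep)
    e-spans : ∀ x → W x → ∃ λ c → x ≈ linComb c e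
    e-spans x x∈W = x ∘ ιʳ , λ j → sym (trans (linComb-pointwise _ e j) (coordinate j (side j)))
      where
      coordinate : ∀ j → Side j → sum (λ s → x (ιʳ s) * e s j) ≡ x j
      coordinate j (left a _ j≡) = begin
        sum (λ s → x (ιʳ s) * e s j)  ≡⟨ sum-cong-≗ (λ s → trans (cong (λ t → x (ιʳ s) * identity (ιʳ s) t) j≡)
                                           (trans (cong (x (ιʳ s) *_) (identity-≢ (λ eq → ιˡ≢ιʳ a s (sym eq)))) (zeroʳ _))) ⟩
        sum {m} (λ _ → 0#)            ≡⟨ sum-replicate-zero m ⟩
        0#                            ≡⟨ x∈W a ⟨
        x (ιˡ a)                      ≡⟨ cong x j≡ ⟨
        x j                           ∎
      coordinate j (right b _ j≡) = begin
        sum (λ s → x (ιʳ s) * e s j)  ≡⟨ sum-cong-≗ (λ s → trans (cong (λ t → x (ιʳ s) * identity (ιʳ s) t) j≡)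
                                           (cong (x (ιʳ s) *_) (identity-∘ ιʳ-injective s b))) ⟩
        sum (λ s → x (ιʳ s) * identity s b) ≡⟨ sum-δʳ (x ∘ ιʳ) b ⟩
        x (ιʳ b)                      ≡⟨ cong x j≡ ⟨
        x j                           ∎

  -- Rank–nullity for π on U: a basis of U ∩ W = ker π and lifts of a basis of πU span U.
  liftedProjection : ∀ {t} (U : Subspace v) → HasDim (elems U) k → HasDim (elems U ∩ˢ W) t →
                     ∃ λ s → k ≤ t ℕ.+ s × Σ (Fin s → Pt v) λ ũ → (∀ i → elems U (ũ i)) × LinIndep (π ∘ ũ)
  liftedProjection (U , U-sub) basis@(β , β∈U , _ , β-spans) (κ , _ , _ , κ-spans)
    with hasDim (rowspace-isSubspace (π ∘ β)) (rowspace? (π ∘ β))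
  ... | s , p , p∈πβ , p-indep , p-spans =
    s , dim≤span (κ ++ ũ) basis U⊆κ++ũ , ũ , ũ∈U , LinIndep-resp (λ i → ≈-sym (πũ≈p i)) p-indep
    where
    ũ : Fin s → Pt v
    ũ i = linComb (proj₁ (p∈πβ i)) β
    ũ∈U : ∀ i → U (ũ i)
    ũ∈U i = linComb-mem U-sub β β∈U (proj₁ (p∈πβ i))
    πũ≈p : ∀ i → π (ũ i) ≈ p i
    πũ≈p i = ≈-trans (linComb-restrict ιˡ _ β) (≈-sym (proj₂ (p∈πβ i)))
    U⊆κ++ũ : U ⊆ rowspace (κ ++ ũ)
    U⊆κ++ũ {x} x∈U = IsSubspace.respects (rowspace-isSubspace (κ ++ ũ)) x-y+y≈x
      (IsSubspace.add-mem (rowspace-isSubspace (κ ++ ũ))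
        (rowspace-++ˡ κ ũ (κ-spans _ x-y∈U∩W)) (rowspace-++ʳ κ ũ (a , ≈-refl)))
      where
      πx∈πβ : rowspace (π ∘ β) (π x)
      πx∈πβ = proj₁ (β-spans x x∈U) , ≈-trans (proj₂ (β-spans x x∈U) ∘ ιˡ) (linComb-restrict ιˡ _ β)
      a : Fin s → Carrier
      a = proj₁ (p-spans (π x) πx∈πβ)
      y : Pt v
      y = linComb a ũ
      πy≈πx : π y ≈ π x
      πy≈πx = ≈-trans (linComb-restrict ιˡ a ũ)
                (≈-trans (linComb-congʳ a πũ≈p) (≈-sym (proj₂ (p-spans (π x) πx∈πβ))))
      x-y∈U∩W : (U ∩ˢ W) (x ⊕ negV y)
      x-y∈U∩W = IsSubspace.add-mem U-sub x∈U (neg-mem U-sub (linComb-mem U-sub ũ ũ∈U a))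
              , λ b → trans (cong (λ z → x (ιˡ b) + - z) (πy≈πx b)) (-‿inverseʳ _)
      x-y+y≈x : ((x ⊕ negV y) ⊕ y) ≈ x
      x-y+y≈x j = trans (+-assoc _ _ _) (trans (cong (x j +_) (-‿inverseˡ _)) (+-identityʳ _))

module Complement {k δ r : ℕ} (r+δ≡1+k : r ℕ.+ δ ≡ suc k) where

  δ+r≰k : ¬ δ ℕ.+ r ≤ k
  δ+r≰k δ+r≤k = ℕP.<-irrefl refl (subst (_≤ k) (trans (ℕP.+-comm δ r) r+δ≡1+k) δ+r≤k)

  complement-≤ : ∀ {t s} → ¬ δ ≤ t → k ≤ t ℕ.+ s → r ≤ s
  complement-≤ {t} {s} δ≰t k≤t+s = ℕP.+-cancelʳ-≤ δ r s (begin
    r ℕ.+ δ    ≡⟨ r+δ≡1+k ⟩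
    suc k      ≤⟨ ℕ.s≤s k≤t+s ⟩
    suc t ℕ.+ s ≤⟨ ℕP.+-monoˡ-≤ s (ℕP.≰⇒> δ≰t) ⟩
    δ ℕ.+ s    ≡⟨ ℕP.+-comm δ s ⟩
    s ℕ.+ δ    ∎)
    where open ℕP.≤-Reasoning

  2δ+2r≰2k : ¬ 2 ℕ.* δ ℕ.+ (r ℕ.+ r) ≤ k ℕ.+ k
  2δ+2r≰2k = ℕP.<⇒≱ (subst (k ℕ.+ k ℕ.<_) (sym 2δ+2r≡2+2k) (ℕP.+-mono-< (ℕP.n<1+n k) (ℕP.n<1+n k)))
    where
    open +-*-Solver
    2δ+2r≡2+2k : 2 ℕ.* δ ℕ.+ (r ℕ.+ r) ≡ suc k ℕ.+ suc k
    2δ+2r≡2+2k = trans (solve 2 (λ δ r → con 2 :* δ :+ (r :+ r) := (r :+ δ) :+ (r :+ δ)) refl δ r)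
                       (cong₂ ℕ._+_ r+δ≡1+k r+δ≡1+k)

module LiftedMRD {q : ℕ} (F : FiniteField q) {v k δ : ℕ} (k≤v : k ≤ v) (δ≤k : δ ≤ k)
                 (M : List (LinAlg.Mat F k (v ∸ k)))
                 (M-dist : LinAlg.Pairwise F (LinAlg.RankDistAtLeast F δ) M)
                 (M-size : length M ≡ q ^ ((v ∸ k) ℕ.* (k ∸ δ ℕ.+ 1))) where
  open FiniteField F
  open LinAlg F
  open LinearAlgebra F
  open Coordinates F k≤v

  r : ℕ
  r = k ∸ δ ℕ.+ 1

  r+δ≡1+k : r ℕ.+ δ ≡ suc k
  r+δ≡1+k = trans (ℕP.+-assoc (k ∸ δ) 1 δ) (trans (ℕP.+-suc (k ∸ δ) δ) (cong suc (ℕP.m∸n+n≡m δ≤k)))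

  open Complement {k} {δ} {r} r+δ≡1+k

  interpolate : (P : Fin r → Pt k) → LinIndep P → (R : Mat r m) → ∃ λ i → ∀ a → linComb (P a) (lookup M i) ≈ R a
  interpolate P P-indep = Encoding.injective⇒onto (vectorEncoding (pointEncoding m) r)
    (trans M-size (sym (ℕP.^-*-assoc q m r))) (λ i a → linComb (P a) (lookup M i)) agree⇒≡
    where
    agree⇒≡ : ∀ {i j} → (∀ a → linComb (P a) (lookup M i) ≈ linComb (P a) (lookup M j)) → i ≡ j
    agree⇒≡ {i} {j} agree with i FinP.≟ j
    ... | yes i≡j = i≡j
    ... | no  i≢j = ⊥-elim (δ+r≰k (rankDist+agree≤rows P P-indep _ _ (M-dist i j i≢j) agree))

  shares-codeword : (u : Fin r → Pt v) → LinIndep (π ∘ u) → ∃ λ i → ∀ a → rowspace (liftMat k≤v (lookup M i)) (u a)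
  shares-codeword u πu-indep with interpolate (π ∘ u) πu-indep (λ a → u a ∘ ιʳ)
  ... | i , interpolates = i , λ a → liftMat-rowspace (lookup M i) ≈-refl (≈-sym (interpolates a))

  SharesCodeword : Subspace v → Set
  SharesCodeword U = Σ (Fin r → Pt v) λ u → LinIndep u × (∀ a → elems U (u a)) ×
                       ∃ λ i → ∀ a → rowspace (liftMat k≤v (lookup M i)) (u a)

  lowMeet⇒sharesCodeword : ∀ {t} (U : Subspace v) → HasDim (elems U) k → HasDim (elems U ∩ˢ W) t → ¬ δ ≤ t →
                           SharesCodeword U
  lowMeet⇒sharesCodeword {t} U dimU dimU∩W δ≰t = lifted (liftedProjection U dimU dimU∩W)
    where
    first-r : ∀ {s} → (∃ λ e → r ℕ.+ e ≡ s) → (ũ : Fin s → Pt v) → (∀ i → elems U (ũ i)) →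
              LinIndep (π ∘ ũ) → SharesCodeword U
    first-r (e , refl) ũ ũ∈U πũ-indep =
      u , LinIndep-restrict ιˡ πu-indep , (λ a → ũ∈U (a ↑ˡ e)) , shares-codeword u πu-indep
      where
      u : Fin r → Pt v
      u a = ũ (a ↑ˡ e)
      πu-indep : LinIndep (π ∘ u)
      πu-indep = LinIndep-↑ˡ πũ-indep
    lifted : (∃ λ s → k ≤ t ℕ.+ s × Σ (Fin s → Pt v) λ ũ → (∀ i → elems U (ũ i)) × LinIndep (π ∘ ũ)) →
             SharesCodeword U
    lifted (s , k≤t+s , ũ , ũ∈U , πũ-indep) =
      first-r (ℕP.m≤n⇒∃[o]m+o≡n (complement-≤ δ≰t k≤t+s)) ũ ũ∈U πũ-indep

  farFromCode⇒meetsW : (U : Subspace v) → HasDim (elems U) k →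
    (∀ i → Σ (Subspace v) λ V → HasDim (elems V) k × DistAtLeast (2 ℕ.* δ) U V ×
                                (rowspace (liftMat k≤v (lookup M i)) ⊆ elems V)) →
    ∃ λ t → HasDim (elems U ∩ˢ W) t × δ ≤ t
  farFromCode⇒meetsW U dimU far =
    meets (hasDim (∩ˢ-isSubspace (proj₂ U) W-isSubspace) (λ x → HasDim⇒dec (proj₂ U) dimU x ×-dec W? x))
    where
    contradict : ¬ SharesCodeword U
    contradict (u , u-indep , u∈U , i , u∈codeword) with far i
    ... | V , dimV , U-far-V , codeword⊆V =
      2δ+2r≰2k (DistAtLeast⇒d+2r≤2k U V dimU dimV U-far-V u u-indep u∈U (codeword⊆V ∘ u∈codeword))
    meets : ∃ (HasDim (elems U ∩ˢ W)) → ∃ λ t → HasDim (elems U ∩ˢ W) t × δ ≤ t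
    meets (t , dimU∩W) with δ ℕ.≤? t
    ... | yes δ≤t = t , dimU∩W , δ≤t
    ... | no  δ≰t = ⊥-elim (contradict (lowMeet⇒sharesCodeword U dimU dimU∩W δ≰t))

even⇒≡2*half : ∀ {d} → 2 ∣ d → d ≡ 2 ℕ.* ⌊ d /2⌋
even⇒≡2*half (divides x refl) =
  trans (ℕP.*-comm x 2) (cong (2 ℕ.*_) (trans (ℕP.n≡⌊n+n/2⌋ x) (cong ⌊_/2⌋ x+x≡x*2)))
  where
  x+x≡x*2 : x ℕ.+ x ≡ x ℕ.* 2
  x+x≡x*2 = trans (cong (x ℕ.+_) (sym (ℕP.+-identityʳ x))) (ℕP.*-comm 2 x)

open LinAlg
open import Data.Nat using (_+_; _*_)

proposition1 : ∀ {q} (F : FiniteField q) (v k d : ℕ)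
    → 1 ≤ v → 1 ≤ k → 1 ≤ d → 2 ∣ d → d ≤ 2 * k → (h : 2 * k ≤ v)
    → (C : List (Subspace F v))
    → (∀ i → HasDim F (elems F (lookup C i)) k)
    → Pairwise F (DistAtLeast F d) C
    → (M : List (Mat F k (v ∸ k)))
    → IsMRD F v k d M
    → (∀ i → ∃ λ j → SameSpace F (rowspace F (liftMat F (2k≤v⇒k≤v h) (lookup M i))) (elems F (lookup C j)))
    → (B : ℕ) → IsBValue F v (v ∸ k) d k B
    → length C ≤ q ^ ((v ∸ k) * (k ∸ ⌊ d /2⌋ + 1)) + B
proposition1 F v k d _ _ _ 2∣d d≤2k h C C-dim C-dist M (M-dist , M-size) M⊆C B (_ , B-max) =
  ℕP.≤-trans length-bound (ℕP.+-mono-≤ (ℕP.≤-reflexive M-size) (B-max rest rest-isBCode))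
  where
  d≡2δ : d ≡ 2 * ⌊ d /2⌋
  d≡2δ = even⇒≡2*half 2∣d
  δ≤k : ⌊ d /2⌋ ≤ k
  δ≤k = ℕP.*-cancelˡ-≤ 2 (subst (_≤ 2 * k) d≡2δ d≤2k)
  k≤v : k ≤ v
  k≤v = 2k≤v⇒k≤v {k} h
  open Coordinates F {v} {k} k≤v using (W; W-isSubspace; W-dim)
  open LiftedMRD F {v} {k} k≤v δ≤k M M-dist M-size using (farFromCode⇒meetsW)
  open LinAlg F using () renaming (_∩ˢ_ to _∩_)
  hit : Fin (length M) → Fin (length C)
  hit i = proj₁ (M⊆C i)
  open Remainder (remainder C hit)
  meetsW : ∀ c → (∀ i → hit i ≢ c) → ∃ λ t → HasDim F (elems F (lookup C c) ∩ W) t × ⌊ d /2⌋ ≤ t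
  meetsW c missed = farFromCode⇒meetsW (lookup C c) (C-dim c) λ i →
    lookup C (hit i) , C-dim (hit i) ,
    subst (λ d′ → DistAtLeast F d′ (lookup C c) (lookup C (hit i))) d≡2δ (C-dist c (hit i) (missed i ∘ sym)) ,
    λ {x} → proj₁ (proj₂ (M⊆C i) x)
  rest-isBCode : IsBCode F v (v ∸ k) d k rest
  rest-isBCode = rest-all (λ U → HasDim F (elems F U) k) (C-dim ∘ index)
               , (λ i j i≢j → subst₂ (DistAtLeast F d) (sym (lookup-rest i)) (sym (lookup-rest j))
                                (C-dist (index i) (index j) (i≢j ∘ index-injective)))
               , (W , W-isSubspace) , W-dim
               , rest-all (λ U → ∃ λ t → HasDim F (elems F U ∩ W) t × ⌊ d /2⌋ ≤ t)
                          (λ i → meetsW (index i) (index-missed i))
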